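{- Let $n\ge 2$. Then $!!n$ and $-\frac{!!n}{2(n-1)}$ are eigenvalues of the matching derangement graph $\Gamma$ on $\mathcal{M}_{2n}$.
   Context: $\mathcal{M}_{2n}$ is the set of perfect matchings of $K_{2n}$; $\Gamma$ has vertex set $\mathcal{M}_{2n}$, two matchings adjacent iff they share no edge. $!!n$ denotes the number of perfect matchings of $K_{2n}$ sharing no edge with a fixed perfect matching (so $\Gamma$ is $!!n$-regular); it satisfies $!!n = 2(n-1)(!!(n-1)+!!(n-2))$ with $!!0=1$, $!!1=0$. -}

module Defs where

open import Data.Nat using (ℕ; zero; suc; _+_; _*_)
open import Data.Fin using (Fin; zero; suc; _≟_)
open import Data.Fin.Properties using (all?)
open import Data.Vec using (Vec; []; _∷_; lookup)
open import Data.List using (List; []; _∷_; [_]; map; concatMap; filter; length; allFin)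
import Data.List as L
open import Data.Product using (_×_; Σ; ∃; _,_)
open import Data.Bool using (if_then_else_)
open import Data.Rational using (ℚ; 0ℚ; 1ℚ) renaming (_+_ to _+ℚ_; _*_ to _*ℚ_)
open import Relation.Nullary using (¬_; Dec; yes; no; ¬?; _×-dec_; does)
open import Relation.Binary.PropositionalEquality using (_≡_; _≢_)

-- !!n : number of perfect matchings of K_{2n} disjoint from a fixed one,
-- via the recurrence !!n = 2(n-1)(!!(n-1) + !!(n-2)), !!0 = 1, !!1 = 0.
dd : ℕ → ℕ
dd zero = 1
dd (suc zero) = 0
dd (suc (suc n)) = 2 * suc n * (dd (suc n) + dd n)

allVecs : ∀ {A : Set} → List A → (m : ℕ) → List (Vec A m)
allVecs xs zero = [ [] ]
allVecs xs (suc m) = concatMap (λ x → map (x ∷_) (allVecs xs m)) xs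

-- A perfect matching of K_k (vertex set Fin k) encoded as its partner map:
-- a fixed-point-free involution, stored as a vector (so equality is syntactic).
IsPerfectMatching : ∀ {k} → Vec (Fin k) k → Set
IsPerfectMatching {k} v = ∀ (i : Fin k) → (lookup v i ≢ i) × (lookup v (lookup v i) ≡ i)

isPerfectMatching? : ∀ {k} (v : Vec (Fin k) k) → Dec (IsPerfectMatching v)
isPerfectMatching? v = all? (λ i → ¬? (lookup v i ≟ i) ×-dec (lookup v (lookup v i) ≟ i))

M : (n : ℕ) → List (Vec (Fin (2 * n)) (2 * n))
M n = filter isPerfectMatching? (allVecs (allFin (2 * n)) (2 * n))

N : ℕ → ℕ
N n = length (M n)

vertex : (n : ℕ) → Fin (N n) → Vec (Fin (2 * n)) (2 * n)
vertex n j = L.lookup (M n) j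

-- Two perfect matchings share no edge iff their partner maps differ everywhere.
ShareNoEdge : ∀ {k} → Vec (Fin k) k → Vec (Fin k) k → Set
ShareNoEdge {k} u w = ∀ (i : Fin k) → lookup u i ≢ lookup w i

shareNoEdge? : ∀ {k} (u w : Vec (Fin k) k) → Dec (ShareNoEdge u w)
shareNoEdge? u w = all? (λ i → ¬? (lookup u i ≟ lookup w i))

adj : (n : ℕ) → Fin (N n) → Fin (N n) → ℚ
adj n i j = if does (shareNoEdge? (vertex n i) (vertex n j)) then 1ℚ else 0ℚ

sumFin : (m : ℕ) → (Fin m → ℚ) → ℚ
sumFin zero f = 0ℚ
sumFin (suc m) f = f zero +ℚ sumFin m (λ i → f (suc i))

IsEigenvalueΓ : (n : ℕ) → ℚ → Set
IsEigenvalueΓ n λ' =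
  Σ (Fin (N n) → ℚ) λ v →
    (∃ λ j → v j ≢ 0ℚ) ×
    (∀ i → sumFin (N n) (λ j → adj n i j *ℚ v j) ≡ λ' *ℚ v i)

module Submission where

-- For a perfect matching w of K_{2n}, the perfect matchings avoiding w are enumerated by pairing the first
-- vertex a with any x other than its w-partner and recursing, continuing with the w-partner of x, which
-- has just lost its own w-partner. The vertices still to be matched then always consist of w-pairs plus at
-- most two loose vertices, and counting both kinds of configuration at once yields the recurrence
-- !!n = 2(n-1)(!!(n-1) + !!(n-2)). So Γ is !!n-regular and the all-ones vector has eigenvalue !!n.
-- The neighbours u of w with u(0) = 1 are exactly the completions of the first choice x = 1: there are
-- !!(n-1) + !!(n-2) = !!n / 2(n-1) of them if {0,1} ∉ w and none otherwise. Hence the vector that is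
-- 2(n-1) on the matchings containing {0,1} and -1 elsewhere is an eigenvector with eigenvalue -!!n / 2(n-1).

open import Defs

open import Data.Bool using (true; false; if_then_else_)
open import Data.Empty using (⊥-elim)
open import Data.Fin using (Fin; zero; suc) renaming (_≟_ to _≟ᶠ_)
import Data.Fin.Properties as Finₚ
open import Data.List using (List; []; _∷_; [_]; filter; length; concatMap; map; allFin)
import Data.List.Properties as Listₚ
open import Data.List.Membership.Propositional using (_∈_; _∉_; find; lose)
open import Data.List.Membership.Propositional.Properties
  using (∈-filter⁺; ∈-filter⁻; ∈-concatMap⁺; ∈-concatMap⁻; ∈-map⁺; ∈-map⁻; ∈-allFin; ∈-lookup)
open import Data.List.Membership.Propositional.Properties.WithK using (unique∧set⇒bag)
open import Data.List.Relation.Binary.BagAndSetEquality using (∼bag⇒↭)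
open import Data.List.Relation.Binary.Permutation.Propositional.Properties using (↭-length)
open import Data.List.Relation.Unary.Any using (here; there; index)
import Data.List.Relation.Unary.All as All
open import Data.List.Relation.Unary.AllPairs using ([]; _∷_)
open import Data.List.Relation.Unary.Unique.Propositional using (Unique)
import Data.List.Relation.Unary.Unique.Propositional.Properties as Uniqueₚ
open import Data.Nat as ℕ using (ℕ; zero; suc; _+_; _*_; _≤_; _<_; s≤s)
import Data.Nat.Properties as ℕₚ
import Data.Integer as ℤ
import Data.Integer.Properties as ℤₚ
import Data.Integer.Solver as ℤ-Solver
open import Data.Rational using (ℚ; _/_; 0ℚ; 1ℚ; -_; toℚᵘ) renaming (_+_ to _+ℚ_; _*_ to _*ℚ_)
import Data.Rational.Properties as ℚₚ
import Data.Rational.Solver as ℚ-Solver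
open import Data.Rational.Unnormalised as ℚᵘ using (mkℚᵘ; *≡*)
import Data.Rational.Unnormalised.Properties as ℚᵘₚ
open import Data.Product using (_×_; _,_; proj₁; proj₂)
open import Data.Vec as Vec using (Vec; lookup; tabulate; _[_]≔_)
import Data.Vec.Properties as Vecₚ
import Data.Nat.Solver as ℕ-Solver
open import Function using (_∘_)
open import Function.Bundles using (mk⇔)
open import Relation.Binary.Definitions using (DecidableEquality)
open import Relation.Binary.PropositionalEquality
  using (_≡_; _≢_; refl; sym; trans; cong; cong₂; subst; module ≡-Reasoning)
open import Relation.Nullary using (¬_; Dec; yes; no; ¬?; does)
open import Relation.Unary using (Decidable)

private
  variable
    A B : Set

length-≡-of-same-elements : ∀ {xs ys : List A} → Unique xs → Unique ys →
  (∀ {z} → z ∈ xs → z ∈ ys) → (∀ {z} → z ∈ ys → z ∈ xs) → length xs ≡ length ys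
length-≡-of-same-elements u v xs⊆ys ys⊆xs =
  ↭-length (∼bag⇒↭ (unique∧set⇒bag u v (mk⇔ xs⊆ys ys⊆xs)))

unique-∷ : ∀ {x : A} {xs} → x ∉ xs → Unique xs → Unique (x ∷ xs)
unique-∷ {xs = xs} x∉ u = All.tabulate (λ z∈ x≡z → x∉ (subst (_∈ xs) (sym x≡z) z∈)) ∷ u

∈-tail : ∀ {x z : A} {xs} → z ∈ x ∷ xs → z ≢ x → z ∈ xs
∈-tail (here z≡x) z≢x = ⊥-elim (z≢x z≡x)
∈-tail (there z∈) _ = z∈

unique-tail : ∀ {x : A} {xs} → Unique (x ∷ xs) → Unique xs
unique-tail (_ ∷ u) = u

head∉tail : ∀ {x : A} {xs} → Unique (x ∷ xs) → x ∉ xs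
head∉tail = Uniqueₚ.Unique[x∷xs]⇒x∉xs

≢-of-∈-∉ : ∀ {x y : A} {xs} → x ∈ xs → y ∉ xs → x ≢ y
≢-of-∈-∉ {xs = xs} x∈ y∉ x≡y = y∉ (subst (_∈ xs) x≡y x∈)

double-suc : ∀ n → 2 * suc n ≡ suc (suc (2 * n))
double-suc n = ℕₚ.*-suc 2 n

length≡0⇒∉ : ∀ {x : A} {xs} → length xs ≡ 0 → x ∉ xs
length≡0⇒∉ {xs = []} _ ()

module Removal {A : Set} (_≟_ : DecidableEquality A) where

  remove : A → List A → List A
  remove x = filter (λ y → ¬? (y ≟ x))

  ∈-remove⁺ : ∀ {x z xs} → z ∈ xs → z ≢ x → z ∈ remove x xs
  ∈-remove⁺ = ∈-filter⁺ (λ y → ¬? (y ≟ _))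

  ∈-remove⁻ : ∀ {x z xs} → z ∈ remove x xs → z ∈ xs × z ≢ x
  ∈-remove⁻ {xs = xs} = ∈-filter⁻ (λ y → ¬? (y ≟ _)) {xs = xs}

  remove-⊆ : ∀ {x z xs} → z ∈ remove x xs → z ∈ xs
  remove-⊆ {xs = xs} = proj₁ ∘ ∈-remove⁻ {xs = xs}

  ∉-remove : ∀ {x xs} → x ∉ remove x xs
  ∉-remove {xs = xs} x∈ = proj₂ (∈-remove⁻ {xs = xs} x∈) refl

  remove-∉ : ∀ {x xs} → x ∉ xs → remove x xs ≡ xs
  remove-∉ {x} {xs} x∉ =
    Listₚ.filter-all (λ y → ¬? (y ≟ x)) (All.tabulate λ z∈ z≡x → x∉ (subst (_∈ xs) z≡x z∈))

  unique-remove : ∀ {x xs} → Unique xs → Unique (remove x xs)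
  unique-remove = Uniqueₚ.filter⁺ (λ y → ¬? (y ≟ _))

  length-remove≤ : ∀ x xs → length (remove x xs) ≤ length xs
  length-remove≤ x = Listₚ.length-filter (λ y → ¬? (y ≟ x))

  length-remove : ∀ {x xs} → Unique xs → x ∈ xs → suc (length (remove x xs)) ≡ length xs
  length-remove {x} {xs} u x∈ =
    length-≡-of-same-elements (unique-∷ (∉-remove {xs = xs}) (unique-remove u)) u to from
    where
      to : ∀ {z} → z ∈ x ∷ remove x xs → z ∈ xs
      to (here refl) = x∈
      to (there z∈) = remove-⊆ {xs = xs} z∈
      from : ∀ {z} → z ∈ xs → z ∈ x ∷ remove x xs
      from {z} z∈ with z ≟ x
      ... | yes z≡x = here z≡x
      ... | no z≢x = there (∈-remove⁺ z∈ z≢x)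

  length-remove₂ : ∀ {x y xs} → Unique xs → x ∈ xs → y ∈ remove x xs →
    suc (suc (length (remove y (remove x xs)))) ≡ length xs
  length-remove₂ u x∈ y∈ = trans (cong suc (length-remove (unique-remove u) y∈)) (length-remove u x∈)

unique-concatMap : ∀ (F : A → List B) (h : B → A) {xs} → Unique xs →
  (∀ {x} → x ∈ xs → Unique (F x)) → (∀ {x y} → x ∈ xs → y ∈ F x → h y ≡ x) →
  Unique (concatMap F xs)
unique-concatMap F h {[]} _ _ _ = []
unique-concatMap F h {x ∷ xs} (x∉ ∷ u) uF hF =
  Uniqueₚ.++⁺ (uF (here refl)) (unique-concatMap F h u (uF ∘ there) (hF ∘ there)) disjoint
  where
    disjoint : ∀ {y} → ¬ (y ∈ F x × y ∈ concatMap F xs)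
    disjoint (y∈Fx , y∈rest) with find (∈-concatMap⁻ F y∈rest)
    ... | x′ , x′∈ , y∈Fx′ =
      All.lookup x∉ x′∈ (trans (sym (hF (here refl) y∈Fx)) (hF (there x′∈) y∈Fx′))

length-concatMap-const : ∀ (F : A → List B) xs c → (∀ {x} → x ∈ xs → length (F x) ≡ c) →
  length (concatMap F xs) ≡ length xs * c
length-concatMap-const F [] c _ = refl
length-concatMap-const F (x ∷ xs) c h =
  trans (Listₚ.length-++ (F x)) (cong₂ _+_ (h (here refl)) (length-concatMap-const F xs c (h ∘ there)))

length-concatMap-const-except : ∀ (F : A → List B) {xs} b c → Unique xs → b ∈ xs →
  (∀ {x} → x ∈ xs → x ≢ b → length (F x) ≡ c) →
  length (concatMap F xs) + c ≡ length (F b) + length xs * c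
length-concatMap-const-except F {x ∷ xs} .x c u (here refl) h = begin
  length (concatMap F (x ∷ xs)) + c
    ≡⟨ cong (_+ c) (Listₚ.length-++ (F x)) ⟩
  length (F x) + length (concatMap F xs) + c
    ≡⟨ cong (λ t → length (F x) + t + c) (length-concatMap-const F xs c h′) ⟩
  length (F x) + length xs * c + c
    ≡⟨ solve 3 (λ a l c → a :+ l :* c :+ c := a :+ (c :+ l :* c)) refl (length (F x)) (length xs) c ⟩
  length (F x) + (c + length xs * c)
    ∎
  where
    open ≡-Reasoning
    open ℕ-Solver.+-*-Solver
    h′ : ∀ {y} → y ∈ xs → length (F y) ≡ c
    h′ y∈ = h (there y∈) (≢-of-∈-∉ y∈ (head∉tail u))
length-concatMap-const-except F {x ∷ xs} b c (x∉ ∷ u) (there b∈) h = begin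
  length (concatMap F (x ∷ xs)) + c
    ≡⟨ cong (_+ c) (Listₚ.length-++ (F x)) ⟩
  length (F x) + length (concatMap F xs) + c
    ≡⟨ cong (λ t → t + length (concatMap F xs) + c) (h (here refl) x≢b) ⟩
  c + length (concatMap F xs) + c
    ≡⟨ ℕₚ.+-assoc c _ c ⟩
  c + (length (concatMap F xs) + c)
    ≡⟨ cong (c +_) (length-concatMap-const-except F b c u b∈ (h ∘ there)) ⟩
  c + (length (F b) + length xs * c)
    ≡⟨ solve 3 (λ a l c → c :+ (a :+ l :* c) := a :+ (c :+ l :* c)) refl (length (F b)) (length xs) c ⟩
  length (F b) + (c + length xs * c)
    ∎
  where
    open ≡-Reasoning
    open ℕ-Solver.+-*-Solver
    x≢b : x ≢ b
    x≢b = All.lookup x∉ b∈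

∈-allVecs : ∀ {xs : List A} m (v : Vec A m) → (∀ x → x ∈ xs) → v ∈ allVecs xs m
∈-allVecs zero Vec.[] _ = here refl
∈-allVecs {xs = xs} (suc m) (x Vec.∷ v) all∈ =
  ∈-concatMap⁺ (λ y → map (y Vec.∷_) (allVecs xs m))
    (lose (all∈ x) (∈-map⁺ (x Vec.∷_) (∈-allVecs m v all∈)))

unique-allVecs : ∀ {xs : List A} m → Unique xs → Unique (allVecs xs m)
unique-allVecs zero _ = All.[] ∷ []
unique-allVecs {xs = xs} (suc m) u =
  unique-concatMap (λ y → map (y Vec.∷_) (allVecs xs m)) Vec.head u
    (λ _ → Uniqueₚ.map⁺ Vecₚ.∷-injectiveʳ (unique-allVecs m u)) head≡
  where
    head≡ : ∀ {x v} → x ∈ xs → v ∈ map (x Vec.∷_) (allVecs xs m) → Vec.head v ≡ x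
    head≡ _ v∈ with ∈-map⁻ (_ Vec.∷_) v∈
    ... | _ , _ , refl = refl

module AvoidingMatchings {k : ℕ} (w : Vec (Fin k) k)
  (w-irreflexive : ∀ i → lookup w i ≢ i) (w-involutive : ∀ i → lookup w (lookup w i) ≡ i) where

  open Removal (_≟ᶠ_ {k}) public
  open import Data.List.Membership.DecPropositional (_≟ᶠ_ {k}) using (_∈?_)

  Vertex : Set
  Vertex = Fin k

  Assignment : Set
  Assignment = Vec Vertex k

  W : Vertex → Vertex
  W = lookup w

  W-injective : ∀ {i j} → W i ≡ W j → i ≡ j
  W-injective {i} {j} Wi≡Wj = trans (sym (w-involutive i)) (trans (cong W Wi≡Wj) (w-involutive j))

  toFront : Vertex → List Vertex → List Vertex
  toFront b xs with b ∈? xs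
  ... | yes _ = b ∷ remove b xs
  ... | no _ = xs

  toFront-∈ : ∀ {b xs} → b ∈ xs → toFront b xs ≡ b ∷ remove b xs
  toFront-∈ {b} {xs} b∈ with b ∈? xs
  ... | yes _ = refl
  ... | no b∉ = ⊥-elim (b∉ b∈)

  toFront-∉ : ∀ {b xs} → b ∉ xs → toFront b xs ≡ xs
  toFront-∉ {b} {xs} b∉ with b ∈? xs
  ... | yes b∈ = ⊥-elim (b∉ b∈)
  ... | no _ = refl

  ∈-toFront⁺ : ∀ {b z xs} → z ∈ xs → z ∈ toFront b xs
  ∈-toFront⁺ {b} {z} {xs} z∈ with b ∈? xs
  ... | no _ = z∈
  ... | yes _ with z ≟ᶠ b
  ...   | yes z≡b = here z≡b
  ...   | no z≢b = there (∈-remove⁺ z∈ z≢b)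

  ∈-toFront⁻ : ∀ {b z xs} → z ∈ toFront b xs → z ∈ xs
  ∈-toFront⁻ {b} {z} {xs} z∈ with b ∈? xs
  ... | no _ = z∈
  ... | yes b∈ with z∈
  ...   | here refl = b∈
  ...   | there z∈′ = remove-⊆ {xs = xs} z∈′

  unique-toFront : ∀ {b xs} → Unique xs → Unique (toFront b xs)
  unique-toFront {b} {xs} u with b ∈? xs
  ... | no _ = u
  ... | yes _ = unique-∷ (∉-remove {xs = xs}) (unique-remove u)

  length-toFront : ∀ {b xs} → Unique xs → length (toFront b xs) ≡ length xs
  length-toFront {b} {xs} u with b ∈? xs
  ... | no _ = refl
  ... | yes b∈ = length-remove u b∈

  -- Once a is matched to x, the vertex W x is loose; processing it next keeps at most two loose vertices.
  reorder : Vertex → List Vertex → List Vertex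
  reorder x rest = toFront (W x) (remove x rest)

  ∈-reorder⁺ : ∀ {x z rest} → z ∈ rest → z ≢ x → z ∈ reorder x rest
  ∈-reorder⁺ z∈ z≢x = ∈-toFront⁺ (∈-remove⁺ z∈ z≢x)

  ∈-reorder⁻ : ∀ {x z rest} → z ∈ reorder x rest → z ∈ rest × z ≢ x
  ∈-reorder⁻ {x} {z} {rest} z∈ = ∈-remove⁻ {xs = rest} (∈-toFront⁻ {W x} {z} {remove x rest} z∈)

  unique-reorder : ∀ {x rest} → Unique rest → Unique (reorder x rest)
  unique-reorder u = unique-toFront (unique-remove u)

  length-reorder≤ : ∀ {x rest} → Unique rest → length (reorder x rest) ≤ length rest
  length-reorder≤ {x} {rest} u =
    subst (_≤ length rest) (sym (length-toFront (unique-remove u))) (length-remove≤ x rest)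

  setPair : Assignment → Vertex → Vertex → Assignment
  setPair acc a x = (acc [ a ]≔ x) [ x ]≔ a

  lookup-setPair-left : ∀ acc {a x} → x ≢ a → lookup (setPair acc a x) a ≡ x
  lookup-setPair-left acc {a} {x} x≢a =
    trans (Vecₚ.lookup∘update′ (x≢a ∘ sym) (acc [ a ]≔ x) a) (Vecₚ.lookup∘update a acc x)

  lookup-setPair-right : ∀ acc a x → lookup (setPair acc a x) x ≡ a
  lookup-setPair-right acc a x = Vecₚ.lookup∘update x (acc [ a ]≔ x) a

  lookup-setPair-other : ∀ acc {a x i} → i ≢ a → i ≢ x → lookup (setPair acc a x) i ≡ lookup acc i
  lookup-setPair-other acc {a} {x} i≢a i≢x =
    trans (Vecₚ.lookup∘update′ i≢x (acc [ a ]≔ x) a) (Vecₚ.lookup∘update′ i≢a acc x)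

  assignment-ext : ∀ {g h : Assignment} → (∀ i → lookup g i ≡ lookup h i) → g ≡ h
  assignment-ext {g} {h} g≗h =
    trans (sym (Vecₚ.tabulate∘lookup g)) (trans (Vecₚ.tabulate-cong g≗h) (Vecₚ.tabulate∘lookup h))

  -- All ways of pairing up the vertices of a list among themselves avoiding w, starting from acc;
  -- the natural number is fuel, sufficient once it is at least the length of the list.
  completions : ℕ → List Vertex → Assignment → List Assignment
  branch : ℕ → Vertex → List Vertex → Assignment → Vertex → List Assignment

  completions _ [] acc = [ acc ]
  completions zero (_ ∷ _) _ = []
  completions (suc f) (a ∷ rest) acc = concatMap (branch f a rest acc) (remove (W a) rest)

  branch f a rest acc x = completions f (reorder x rest) (setPair acc a x)

  record PairedWithin (vs : List Vertex) (g : Assignment) (i : Vertex) : Set where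
    field
      partner∈ : lookup g i ∈ vs
      partner≢ : lookup g i ≢ i
      partner-involutive : lookup g (lookup g i) ≡ i
      partner≢W : lookup g i ≢ W i

  record Completion (vs : List Vertex) (acc g : Assignment) : Set where
    field
      outside : ∀ i → i ∉ vs → lookup g i ≡ lookup acc i
      inside : ∀ i → i ∈ vs → PairedWithin vs g i

  open PairedWithin
  open Completion

  pairedWithin-⊆ : ∀ {vs vs′ g i} → (∀ {z} → z ∈ vs → z ∈ vs′) →
    PairedWithin vs g i → PairedWithin vs′ g i
  pairedWithin-⊆ vs⊆vs′ p = record
    { partner∈ = vs⊆vs′ (partner∈ p) ; partner≢ = partner≢ p
    ; partner-involutive = partner-involutive p ; partner≢W = partner≢W p }

  completions-sound : ∀ f {vs acc g} → Unique vs → g ∈ completions f vs acc → Completion vs acc g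
  branch-completion : ∀ f {a rest acc x g} → Unique (a ∷ rest) → g ∈ branch f a rest acc x →
    Completion (reorder x rest) (setPair acc a x) g
  branch-pivot : ∀ f {a rest acc x g} → Unique (a ∷ rest) → x ∈ remove (W a) rest →
    g ∈ branch f a rest acc x → lookup g a ≡ x
  branch-sound : ∀ f {a rest acc x g} → Unique (a ∷ rest) → x ∈ remove (W a) rest →
    g ∈ branch f a rest acc x → Completion (a ∷ rest) acc g

  completions-sound f {[]} _ (here refl) = record { outside = λ _ _ → refl ; inside = λ _ () }
  completions-sound (suc f) {a ∷ rest} {acc} u g∈ with find (∈-concatMap⁻ (branch f a rest acc) g∈)
  ... | x , x∈ , g∈x = branch-sound f u x∈ g∈x

  branch-completion f u = completions-sound f (unique-reorder (unique-tail u))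

  branch-pivot f {a} {rest} {acc} u x∈ g∈ =
    trans (outside (branch-completion f u g∈) a a∉)
          (lookup-setPair-left acc (≢-of-∈-∉ (remove-⊆ {xs = rest} x∈) (head∉tail u)))
    where
      a∉ : a ∉ reorder _ rest
      a∉ a∈ = head∉tail u (proj₁ (∈-reorder⁻ {rest = rest} a∈))

  branch-sound f {a} {rest} {acc} {x} {g} u x∈ g∈ = record { outside = outside′ ; inside = inside′ }
    where
      c = branch-completion f u g∈
      x∈rest = remove-⊆ {xs = rest} x∈
      x≢Wa = proj₂ (∈-remove⁻ {xs = rest} x∈)
      x≢a = ≢-of-∈-∉ x∈rest (head∉tail u)
      g-a : lookup g a ≡ x
      g-a = branch-pivot f u x∈ g∈
      g-x : lookup g x ≡ a
      g-x = trans (outside c x (λ x∈′ → proj₂ (∈-reorder⁻ {rest = rest} x∈′) refl))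
                  (lookup-setPair-right acc a x)
      outside′ : ∀ i → i ∉ a ∷ rest → lookup g i ≡ lookup acc i
      outside′ i i∉ = trans (outside c i (λ i∈ → i∉ (there (proj₁ (∈-reorder⁻ {rest = rest} i∈)))))
        (lookup-setPair-other acc (i∉ ∘ here) (λ i≡x → i∉ (there (subst (_∈ rest) (sym i≡x) x∈rest))))
      inside′ : ∀ i → i ∈ a ∷ rest → PairedWithin (a ∷ rest) g i
      inside′ i (here refl) = record
        { partner∈ = subst (_∈ a ∷ rest) (sym g-a) (there x∈rest)
        ; partner≢ = λ gi≡i → x≢a (trans (sym g-a) gi≡i)
        ; partner-involutive = trans (cong (lookup g) g-a) g-x
        ; partner≢W = λ gi≡Wi → x≢Wa (trans (sym g-a) gi≡Wi) }
      inside′ i (there i∈) with i ≟ᶠ x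
      ... | yes refl = record
        { partner∈ = subst (_∈ a ∷ rest) (sym g-x) (here refl)
        ; partner≢ = λ gx≡x → x≢a (trans (sym gx≡x) g-x)
        ; partner-involutive = trans (cong (lookup g) g-x) g-a
        ; partner≢W = λ gx≡Wx → x≢Wa (trans (sym (w-involutive x)) (cong W (trans (sym gx≡Wx) g-x))) }
      ... | no i≢x =
        pairedWithin-⊆ (there ∘ proj₁ ∘ ∈-reorder⁻ {rest = rest}) (inside c i (∈-reorder⁺ i∈ i≢x))

  branch⊆completions : ∀ f {a rest acc x g} → x ∈ remove (W a) rest → g ∈ branch f a rest acc x →
    g ∈ completions (suc f) (a ∷ rest) acc
  branch⊆completions f {a} {rest} {acc} x∈ g∈ = ∈-concatMap⁺ (branch f a rest acc) (lose x∈ g∈)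

  completions⊆branch : ∀ f {a rest acc x g} → Unique (a ∷ rest) →
    g ∈ completions (suc f) (a ∷ rest) acc → lookup g a ≡ x → g ∈ branch f a rest acc x
  completions⊆branch f {a} {rest} {acc} u g∈ g-a with find (∈-concatMap⁻ (branch f a rest acc) g∈)
  ... | x′ , x′∈ , g∈′ =
    subst (λ y → _ ∈ branch f a rest acc y) (trans (sym (branch-pivot f u x′∈ g∈′)) g-a) g∈′

  completion-pivot : ∀ {a rest acc g} → Unique (a ∷ rest) → Completion (a ∷ rest) acc g →
    lookup g a ∈ remove (W a) rest × Completion (reorder (lookup g a) rest) (setPair acc a (lookup g a)) g
  completion-pivot {a} {rest} {acc} {g} u c = ∈-remove⁺ x∈rest (partner≢W pa) , record
    { outside = outside′ ; inside = inside′ }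
    where
      pa = inside c a (here refl)
      x = lookup g a
      x≢a = partner≢ pa
      g-x : lookup g x ≡ a
      g-x = partner-involutive pa
      x∈rest = ∈-tail (partner∈ pa) x≢a
      outside′ : ∀ i → i ∉ reorder x rest → lookup g i ≡ lookup (setPair acc a x) i
      outside′ i i∉ with i ≟ᶠ a | i ≟ᶠ x
      ... | yes refl | _ = sym (lookup-setPair-left acc x≢a)
      ... | no _ | yes refl = trans g-x (sym (lookup-setPair-right acc a x))
      ... | no i≢a | no i≢x =
        trans (outside c i (λ i∈ → i∉ (∈-reorder⁺ (∈-tail i∈ i≢a) i≢x)))
              (sym (lookup-setPair-other acc i≢a i≢x))
      inside′ : ∀ i → i ∈ reorder x rest → PairedWithin (reorder x rest) g i
      inside′ i i∈ = record
        { partner∈ = ∈-reorder⁺ (∈-tail (partner∈ pi) gi≢a) gi≢x ; partner≢ = partner≢ pi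
        ; partner-involutive = partner-involutive pi ; partner≢W = partner≢W pi }
        where
          i∈rest = proj₁ (∈-reorder⁻ {rest = rest} i∈)
          pi = inside c i (there i∈rest)
          gi≢a : lookup g i ≢ a
          gi≢a gi≡a =
            proj₂ (∈-reorder⁻ {rest = rest} i∈) (trans (sym (partner-involutive pi)) (cong (lookup g) gi≡a))
          gi≢x : lookup g i ≢ x
          gi≢x gi≡x = head∉tail u
            (subst (_∈ rest) (trans (sym (partner-involutive pi)) (trans (cong (lookup g) gi≡x) g-x)) i∈rest)

  completions-complete : ∀ f {vs acc g} → Unique vs → length vs ≤ f → Completion vs acc g →
    g ∈ completions f vs acc
  completions-complete f {[]} _ _ c = here (assignment-ext (λ i → outside c i λ ()))
  completions-complete zero {_ ∷ _} _ () _
  completions-complete (suc f) {a ∷ rest} {acc} u (s≤s lf) c with completion-pivot u c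
  ... | x∈ , c′ = branch⊆completions f {rest = rest} x∈ (completions-complete f (unique-reorder ur)
                    (ℕₚ.≤-trans (length-reorder≤ ur) lf) c′)
    where ur = unique-tail u

  unique-completions : ∀ f {vs acc} → Unique vs → Unique (completions f vs acc)
  unique-branch : ∀ f {a rest acc x} → Unique (a ∷ rest) → Unique (branch f a rest acc x)

  unique-completions f {[]} _ = All.[] ∷ []
  unique-completions zero {_ ∷ _} _ = []
  unique-completions (suc f) {a ∷ rest} {acc} u =
    unique-concatMap (branch f a rest acc) (λ g → lookup g a) (unique-remove (unique-tail u))
      (λ _ → unique-branch f u) (branch-pivot f u)

  unique-branch f u = unique-completions f (unique-reorder (unique-tail u))

  Closed : List Vertex → Set
  Closed vs = ∀ {y} → y ∈ vs → W y ∈ vs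

  -- Every vertex of a ∷ rest other than a and b has its w-partner in a ∷ rest; the w-partner of b
  -- is missing, and that of a is missing or is b itself.
  record OpenEnds (a b : Vertex) (rest : List Vertex) : Set where
    field
      unique : Unique (a ∷ rest)
      end∈ : b ∈ rest
      W-end∉ : W b ∉ rest
      W⁻¹-pivot : ∀ {y} → y ∈ rest → W y ≡ a → y ≡ b
      closed : ∀ {y} → y ∈ rest → y ≢ b → W y ∈ a ∷ rest

  open OpenEnds

  closed⇒openEnds : ∀ {a rest} → Unique (a ∷ rest) → Closed (a ∷ rest) → OpenEnds a (W a) rest
  closed⇒openEnds {a} {rest} u cl = record
    { unique = u
    ; end∈ = ∈-tail (cl (here refl)) (w-irreflexive a)
    ; W-end∉ = λ WWa∈ → head∉tail u (subst (_∈ rest) (w-involutive a) WWa∈)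
    ; W⁻¹-pivot = λ {y} _ Wy≡a → trans (sym (w-involutive y)) (cong W Wy≡a)
    ; closed = λ y∈ _ → cl (there y∈) }

  openEnds-closed : ∀ {a b rest} → OpenEnds a b rest → Closed (remove b rest)
  openEnds-closed {a} {b} {rest} ends {y} y∈ = ∈-remove⁺ (∈-tail (closed ends y∈rest y≢b) Wy≢a) Wy≢b
    where
      y∈rest = remove-⊆ {xs = rest} y∈
      y≢b = proj₂ (∈-remove⁻ {xs = rest} y∈)
      Wy≢a : W y ≢ a
      Wy≢a = y≢b ∘ W⁻¹-pivot ends y∈rest
      Wy≢b : W y ≢ b
      Wy≢b Wy≡b = W-end∉ ends (subst (_∈ rest) (trans (sym (w-involutive y)) (cong W Wy≡b)) y∈rest)

  openEnds-step : ∀ {a b rest x} → OpenEnds a b rest → x ∈ rest → x ≢ b →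
    let rest′ = remove (W x) (remove x rest) in
    W x ∈ remove x rest × OpenEnds (W x) b rest′ × W (W x) ∉ rest′
  openEnds-step {a} {b} {rest} {x} ends x∈ x≢b = Wx∈′ , ends′ , WWx∉
    where
      rest′ = remove (W x) (remove x rest)
      ⊆rest : ∀ {z} → z ∈ rest′ → z ∈ rest × z ≢ x × z ≢ W x
      ⊆rest z∈ with ∈-remove⁻ {xs = remove x rest} z∈
      ... | z∈′ , z≢Wx with ∈-remove⁻ {xs = rest} z∈′
      ...   | z∈ , z≢x = z∈ , z≢x , z≢Wx
      ur = unique-tail (unique ends)
      Wx∈ : W x ∈ rest
      Wx∈ = ∈-tail (closed ends x∈ x≢b) (x≢b ∘ W⁻¹-pivot ends x∈)
      Wx∈′ = ∈-remove⁺ Wx∈ (w-irreflexive x)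
      WWx∉ : W (W x) ∉ rest′
      WWx∉ WWx∈ = proj₁ (proj₂ (⊆rest WWx∈)) (w-involutive x)
      closed′ : ∀ {y} → y ∈ rest′ → y ≢ b → W y ∈ W x ∷ rest′
      closed′ {y} y∈ y≢b with W y ≟ᶠ W x | ⊆rest y∈
      ... | yes Wy≡Wx | _ = here Wy≡Wx
      ... | no Wy≢Wx | y∈rest , _ , y≢Wx = there (∈-remove⁺ (∈-remove⁺ Wy∈ Wy≢x) Wy≢Wx)
        where
          Wy∈ = ∈-tail (closed ends y∈rest y≢b) (y≢b ∘ W⁻¹-pivot ends y∈rest)
          Wy≢x : W y ≢ x
          Wy≢x Wy≡x = y≢Wx (trans (sym (w-involutive y)) (cong W Wy≡x))
      b≢Wx : b ≢ W x
      b≢Wx b≡Wx = W-end∉ ends (subst (_∈ rest) (trans (sym (w-involutive x)) (cong W (sym b≡Wx))) x∈)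
      ends′ : OpenEnds (W x) b rest′
      ends′ = record
        { unique = unique-∷ (∉-remove {xs = remove x rest}) (unique-remove (unique-remove ur))
        ; end∈ = ∈-remove⁺ (∈-remove⁺ (end∈ ends) (x≢b ∘ sym)) b≢Wx
        ; W-end∉ = λ Wb∈ → W-end∉ ends (proj₁ (⊆rest Wb∈))
        ; W⁻¹-pivot = λ y∈ Wy≡Wx → ⊥-elim (proj₁ (proj₂ (⊆rest y∈)) (W-injective Wy≡Wx))
        ; closed = closed′ }

  length-choices : ∀ {a rest n} → Unique (a ∷ rest) → Closed (a ∷ rest) →
    length (a ∷ rest) ≡ 2 * suc n → length (remove (W a) rest) ≡ 2 * n
  length-choices {a} {rest} {n} u cl len = ℕₚ.suc-injective (ℕₚ.suc-injective (begin
    suc (suc (length (remove (W a) rest))) ≡⟨ cong suc (length-remove (unique-tail u) Wa∈) ⟩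
    suc (length rest)                     ≡⟨ len ⟩
    2 * suc n                             ≡⟨ double-suc n ⟩
    suc (suc (2 * n))                     ∎))
    where
      open ≡-Reasoning
      Wa∈ = end∈ (closed⇒openEnds u cl)

  length-completions-closed : ∀ n f vs acc → Unique vs → Closed vs →
    length vs ≡ 2 * n → length vs ≤ f → length (completions f vs acc) ≡ dd n
  length-completions-open : ∀ n f a b rest acc → OpenEnds a b rest → W a ∉ rest →
    length rest ≡ suc (2 * n) → length rest < f → length (completions f (a ∷ rest) acc) ≡ dd (suc n) + dd n
  length-branch-end : ∀ n f a b rest acc → OpenEnds a b rest →
    length rest ≡ suc (2 * n) → length rest ≤ f → length (branch f a rest acc b) ≡ dd n
  length-branch-inner : ∀ n f a b rest acc x → OpenEnds a b rest → x ∈ rest → x ≢ b →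
    length rest ≡ suc (2 * suc n) → length rest ≤ f → length (branch f a rest acc x) ≡ dd (suc n) + dd n

  length-completions-closed zero _ [] _ _ _ _ _ = refl
  length-completions-closed (suc _) _ [] _ _ _ () _
  length-completions-closed zero _ (_ ∷ _) _ _ _ () _
  length-completions-closed (suc _) zero (_ ∷ _) _ _ _ _ ()
  length-completions-closed (suc zero) (suc f) (a ∷ rest) acc u cl len _ =
    trans (length-concatMap-const (branch f a rest acc) (remove (W a) rest) 0
            (λ x∈ → ⊥-elim (length≡0⇒∉ (length-choices {n = 0} u cl len) x∈)))
          (cong (_* 0) (length-choices {n = 0} u cl len))
  length-completions-closed (suc (suc n)) (suc f) (a ∷ rest) acc u cl len (s≤s lf) =
    trans (length-concatMap-const (branch f a rest acc) (remove (W a) rest) (dd (suc n) + dd n) branch-length)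
          (cong (_* (dd (suc n) + dd n)) (length-choices {n = suc n} u cl len))
    where
      branch-length : ∀ {x} → x ∈ remove (W a) rest → length (branch f a rest acc x) ≡ dd (suc n) + dd n
      branch-length {x} x∈ = length-branch-inner n f a (W a) rest acc x (closed⇒openEnds u cl)
        (remove-⊆ {xs = rest} x∈) (proj₂ (∈-remove⁻ {xs = rest} x∈))
        (ℕₚ.suc-injective (trans len (double-suc (suc n)))) lf

  length-completions-open _ zero _ _ _ _ _ _ _ ()
  length-completions-open zero (suc f) a b rest acc ends Wa∉ len (s≤s lf) rewrite remove-∉ Wa∉ =
    ℕₚ.+-cancelʳ-≡ 0 _ _ (begin
      length (concatMap F rest) + 0        ≡⟨ length-concatMap-const-except F b 0 ur (end∈ ends) no-inner ⟩
      length (F b) + length rest * 0       ≡⟨ cong₂ _+_ (length-branch-end 0 f a b rest acc ends len lf)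
                                                         (ℕₚ.*-zeroʳ (length rest)) ⟩
      1 + 0                                ∎)
    where
      open ≡-Reasoning
      F = branch f a rest acc
      ur = unique-tail (unique ends)
      no-inner : ∀ {x} → x ∈ rest → x ≢ b → length (F x) ≡ 0
      no-inner x∈ x≢b =
        ⊥-elim (length≡0⇒∉ (ℕₚ.suc-injective (trans (length-remove ur (end∈ ends)) len)) (∈-remove⁺ x∈ x≢b))
  length-completions-open (suc n) (suc f) a b rest acc ends Wa∉ len (s≤s lf) rewrite remove-∉ Wa∉ =
    ℕₚ.+-cancelʳ-≡ c _ _ (begin
      length (concatMap F rest) + c        ≡⟨ length-concatMap-const-except F b c (unique-tail (unique ends)) (end∈ ends)
                                                (λ x∈ x≢b → length-branch-inner n f a b rest acc _ ends x∈ x≢b len lf) ⟩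
      length (F b) + length rest * c       ≡⟨ cong (_+ length rest * c)
                                                (length-branch-end (suc n) f a b rest acc ends len lf) ⟩
      dd (suc n) + length rest * c         ≡⟨ cong (λ t → dd (suc n) + t * c) len ⟩
      dd (suc n) + suc (2 * suc n) * c     ≡⟨ solve 3 (λ d c e → d :+ (c :+ e) := (e :+ d) :+ c) refl
                                                (dd (suc n)) c (2 * suc n * c) ⟩
      dd (suc (suc n)) + dd (suc n) + c    ∎)
    where
      open ≡-Reasoning
      open ℕ-Solver.+-*-Solver
      F = branch f a rest acc
      c = dd (suc n) + dd n

  length-branch-end n f a b rest acc ends len lf =
    trans (cong (λ vs → length (completions f vs (setPair acc a b)))
                (toFront-∉ (W-end∉ ends ∘ remove-⊆ {xs = rest})))
          (length-completions-closed n f (remove b rest) (setPair acc a b)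
            (unique-remove (unique-tail (unique ends))) (openEnds-closed ends)
            (ℕₚ.suc-injective (trans (length-remove (unique-tail (unique ends)) (end∈ ends)) len))
            (ℕₚ.≤-trans (length-remove≤ b rest) lf))

  length-branch-inner n f a b rest acc x ends x∈ x≢b len lf with openEnds-step ends x∈ x≢b
  ... | Wx∈ , ends′ , WWx∉ =
    trans (cong (λ vs → length (completions f vs (setPair acc a x))) (toFront-∈ Wx∈))
          (length-completions-open n f (W x) b rest′ (setPair acc a x) ends′ WWx∉
            (ℕₚ.suc-injective (ℕₚ.suc-injective (trans shrink (trans len (cong suc (double-suc n))))))
            (ℕₚ.≤-trans (ℕₚ.n≤1+n _) (subst (_≤ f) (sym shrink) lf)))
    where
      rest′ = remove (W x) (remove x rest)
      shrink : suc (suc (length rest′)) ≡ length rest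
      shrink = length-remove₂ (unique-tail (unique ends)) x∈ Wx∈

ι : ℕ → ℚ
ι n = ℤ.+ n / 1

ι-suc : ∀ n → ι (suc n) ≡ 1ℚ +ℚ ι n
ι-suc n = ℚₚ.toℚᵘ-injective (begin
  toℚᵘ (ι (suc n))                  ≈⟨ ℚₚ.toℚᵘ-fromℚᵘ (mkℚᵘ (ℤ.+ suc n) 0) ⟩
  mkℚᵘ (ℤ.+ suc n) 0                ≈⟨ *≡* (solve 1 (λ x → (one :+ x) :* one := (one :* one :+ x :* one) :* one)
                                                   refl (ℤ.+ n)) ⟩
  mkℚᵘ (ℤ.+ 1) 0 ℚᵘ.+ mkℚᵘ (ℤ.+ n) 0 ≈⟨ ℚᵘₚ.+-congʳ (mkℚᵘ (ℤ.+ 1) 0) (ℚᵘₚ.≃-sym (ℚₚ.toℚᵘ-fromℚᵘ (mkℚᵘ (ℤ.+ n) 0))) ⟩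
  toℚᵘ 1ℚ ℚᵘ.+ toℚᵘ (ι n)           ≈⟨ ℚᵘₚ.≃-sym (ℚₚ.toℚᵘ-homo-+ 1ℚ (ι n)) ⟩
  toℚᵘ (1ℚ +ℚ ι n)                  ∎)
  where
    open ℚᵘₚ.≃-Reasoning
    open ℤ-Solver.+-*-Solver
    one = con (ℤ.+ 1)

ι-+ : ∀ a b → ι (a + b) ≡ ι a +ℚ ι b
ι-+ zero b = sym (ℚₚ.+-identityˡ (ι b))
ι-+ (suc a) b = begin
  ι (suc (a + b))         ≡⟨ ι-suc (a + b) ⟩
  1ℚ +ℚ ι (a + b)         ≡⟨ cong (1ℚ +ℚ_) (ι-+ a b) ⟩
  1ℚ +ℚ (ι a +ℚ ι b)      ≡⟨ sym (ℚₚ.+-assoc 1ℚ (ι a) (ι b)) ⟩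
  (1ℚ +ℚ ι a) +ℚ ι b      ≡⟨ cong (_+ℚ ι b) (sym (ι-suc a)) ⟩
  ι (suc a) +ℚ ι b        ∎
  where open ≡-Reasoning

ι-* : ∀ a b → ι (a * b) ≡ ι a *ℚ ι b
ι-* zero b = sym (ℚₚ.*-zeroˡ (ι b))
ι-* (suc a) b = begin
  ι (b + a * b)           ≡⟨ ι-+ b (a * b) ⟩
  ι b +ℚ ι (a * b)        ≡⟨ cong (ι b +ℚ_) (ι-* a b) ⟩
  ι b +ℚ ι a *ℚ ι b       ≡⟨ solve 2 (λ x y → y :+ x :* y := (con 1ℚ :+ x) :* y) refl (ι a) (ι b) ⟩
  (1ℚ +ℚ ι a) *ℚ ι b      ≡⟨ cong (_*ℚ ι b) (sym (ι-suc a)) ⟩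
  ι (suc a) *ℚ ι b        ∎
  where
    open ≡-Reasoning
    open ℚ-Solver.+-*-Solver

ι-/ : ∀ d q .{{_ : ℕ.NonZero d}} → ℤ.+ (d * q) / d ≡ ι q
ι-/ (suc d) q = ℚₚ.fromℚᵘ-cong {mkℚᵘ (ℤ.+ (suc d * q)) d} {mkℚᵘ (ℤ.+ q) 0}
  (*≡* (trans (ℤₚ.*-identityʳ _) (trans (ℤₚ.pos-* (suc d) q) (ℤₚ.*-comm (ℤ.+ suc d) (ℤ.+ q)))))

ι-nonzero : ∀ n .{{_ : ℕ.NonZero n}} → ι n ≢ 0ℚ
ι-nonzero n ι≡0 = ℚₚ.<-irrefl (sym ι≡0) (ℚₚ.positive⁻¹ (ι n) {{ℚₚ.normalize-pos n 1}})

sumOver : List A → (A → ℚ) → ℚ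
sumOver [] h = 0ℚ
sumOver (x ∷ xs) h = h x +ℚ sumOver xs h

sumFin-lookup : ∀ (xs : List A) h → sumFin (length xs) (h ∘ Data.List.lookup xs) ≡ sumOver xs h
sumFin-lookup [] h = refl
sumFin-lookup (x ∷ xs) h = cong (h x +ℚ_) (sumFin-lookup xs h)

sumOver-cong : ∀ (xs : List A) {h h′} → (∀ x → h x ≡ h′ x) → sumOver xs h ≡ sumOver xs h′
sumOver-cong [] _ = refl
sumOver-cong (x ∷ xs) h≗h′ = cong₂ _+ℚ_ (h≗h′ x) (sumOver-cong xs h≗h′)

sumOver-+ : ∀ (xs : List A) h h′ → sumOver xs (λ x → h x +ℚ h′ x) ≡ sumOver xs h +ℚ sumOver xs h′
sumOver-+ [] h h′ = sym (ℚₚ.+-identityˡ 0ℚ)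
sumOver-+ (x ∷ xs) h h′ = begin
  (h x +ℚ h′ x) +ℚ sumOver xs (λ y → h y +ℚ h′ y)
    ≡⟨ cong ((h x +ℚ h′ x) +ℚ_) (sumOver-+ xs h h′) ⟩
  (h x +ℚ h′ x) +ℚ (sumOver xs h +ℚ sumOver xs h′)
    ≡⟨ solve 4 (λ a b c d → (a :+ b) :+ (c :+ d) := (a :+ c) :+ (b :+ d)) refl
         (h x) (h′ x) (sumOver xs h) (sumOver xs h′) ⟩
  (h x +ℚ sumOver xs h) +ℚ (h′ x +ℚ sumOver xs h′)
    ∎
  where
    open ≡-Reasoning
    open ℚ-Solver.+-*-Solver

sumOver-const : ∀ (xs : List A) c → sumOver xs (λ _ → c) ≡ ι (length xs) *ℚ c
sumOver-const [] c = sym (ℚₚ.*-zeroˡ c)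
sumOver-const (x ∷ xs) c = begin
  c +ℚ sumOver xs (λ _ → c)       ≡⟨ cong (c +ℚ_) (sumOver-const xs c) ⟩
  c +ℚ ι (length xs) *ℚ c         ≡⟨ solve 2 (λ c l → c :+ l :* c := (con 1ℚ :+ l) :* c) refl c (ι (length xs)) ⟩
  (1ℚ +ℚ ι (length xs)) *ℚ c      ≡⟨ cong (_*ℚ c) (sym (ι-suc (length xs))) ⟩
  ι (suc (length xs)) *ℚ c        ∎
  where
    open ≡-Reasoning
    open ℚ-Solver.+-*-Solver

indicator : {P : A → Set} → Decidable P → A → ℚ
indicator P? x = if does (P? x) then 1ℚ else 0ℚ

sumOver-filter : ∀ {P : A → Set} (P? : Decidable P) xs h →
  sumOver xs (λ x → indicator P? x *ℚ h x) ≡ sumOver (filter P? xs) h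
sumOver-filter P? [] h = refl
sumOver-filter P? (x ∷ xs) h with does (P? x)
... | true = cong₂ _+ℚ_ (ℚₚ.*-identityˡ (h x)) (sumOver-filter P? xs h)
... | false = trans (cong₂ _+ℚ_ (ℚₚ.*-zeroˡ (h x)) (sumOver-filter P? xs h)) (ℚₚ.+-identityˡ _)

Matching : ℕ → Set
Matching n = Vec (Fin (2 * n)) (2 * n)

unique-M : ∀ n → Unique (M n)
unique-M n = Uniqueₚ.filter⁺ isPerfectMatching? (unique-allVecs (2 * n) (Uniqueₚ.allFin⁺ (2 * n)))

∈-M⁺ : ∀ n (u : Matching n) → IsPerfectMatching u → u ∈ M n
∈-M⁺ n u = ∈-filter⁺ isPerfectMatching? (∈-allVecs (2 * n) u ∈-allFin)

∈-M⁻ : ∀ n {u : Matching n} → u ∈ M n → IsPerfectMatching u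
∈-M⁻ n u∈ = proj₂ (∈-filter⁻ isPerfectMatching? {xs = allVecs (allFin (2 * n)) (2 * n)} u∈)

data Even : ℕ → Set where
  even-zero : Even zero
  even-suc-suc : ∀ {k} → Even k → Even (suc (suc k))

even-double : ∀ n → Even (2 * n)
even-double zero = even-zero
even-double (suc n) = subst Even (sym (double-suc n)) (even-suc-suc (even-double n))

swapPairs : ∀ {k} → Fin k → Fin k
swapPairs {suc zero} zero = zero
swapPairs {suc (suc k)} zero = suc zero
swapPairs {suc (suc k)} (suc zero) = zero
swapPairs {suc (suc k)} (suc (suc i)) = suc (suc (swapPairs i))

swapPairs-involutive : ∀ {k} (i : Fin k) → swapPairs (swapPairs i) ≡ i
swapPairs-involutive {suc zero} zero = refl
swapPairs-involutive {suc (suc k)} zero = refl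
swapPairs-involutive {suc (suc k)} (suc zero) = refl
swapPairs-involutive {suc (suc k)} (suc (suc i)) = cong (λ j → suc (suc j)) (swapPairs-involutive i)

swapPairs-irreflexive : ∀ {k} → Even k → (i : Fin k) → swapPairs i ≢ i
swapPairs-irreflexive (even-suc-suc _) zero ()
swapPairs-irreflexive (even-suc-suc _) (suc zero) ()
swapPairs-irreflexive (even-suc-suc e) (suc (suc i)) eq =
  swapPairs-irreflexive e i (Finₚ.suc-injective (Finₚ.suc-injective eq))

isPerfectMatching-swapPairs : ∀ n → IsPerfectMatching (tabulate (swapPairs {2 * n}))
isPerfectMatching-swapPairs n i
  rewrite Vecₚ.lookup∘tabulate (swapPairs {2 * n}) i
        | Vecₚ.lookup∘tabulate (swapPairs {2 * n}) (swapPairs i)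
        = swapPairs-irreflexive (even-double n) i , swapPairs-involutive i

some-vertex : ∀ n → Fin (N n)
some-vertex n = index (∈-M⁺ n (tabulate swapPairs) (isPerfectMatching-swapPairs n))

neighbours : ∀ n → Matching n → List (Matching n)
neighbours n w = filter (shareNoEdge? w) (M n)

module Neighbours {n : ℕ} (w : Matching n) (w-pm : IsPerfectMatching w) where

  open AvoidingMatchings w (proj₁ ∘ w-pm) (proj₂ ∘ w-pm)
  open Completion
  open PairedWithin

  ∈-neighbours⁺ : ∀ {g} → g ∈ completions (2 * n) (allFin (2 * n)) w → g ∈ neighbours n w
  ∈-neighbours⁺ g∈ = ∈-filter⁺ (shareNoEdge? w) (∈-M⁺ n _ pm) (λ i → partner≢W (p i) ∘ sym)
    where
      c = completions-sound (2 * n) (Uniqueₚ.allFin⁺ (2 * n)) g∈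
      p = λ i → inside c i (∈-allFin i)
      pm = λ i → partner≢ (p i) , partner-involutive (p i)

  ∈-neighbours⁻ : ∀ {g} → g ∈ neighbours n w → g ∈ completions (2 * n) (allFin (2 * n)) w
  ∈-neighbours⁻ g∈ with ∈-filter⁻ (shareNoEdge? w) {xs = M n} g∈
  ... | g∈M , sne = completions-complete (2 * n) (Uniqueₚ.allFin⁺ (2 * n))
    (ℕₚ.≤-reflexive (Listₚ.length-tabulate _)) (record
      { outside = λ i i∉ → ⊥-elim (i∉ (∈-allFin i))
      ; inside = λ i _ → record
        { partner∈ = ∈-allFin _ ; partner≢ = proj₁ (∈-M⁻ n g∈M i)
        ; partner-involutive = proj₂ (∈-M⁻ n g∈M i) ; partner≢W = sne i ∘ sym } })

  length-neighbours : length (neighbours n w) ≡ dd n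
  length-neighbours = begin
    length (neighbours n w)
      ≡⟨ length-≡-of-same-elements (Uniqueₚ.filter⁺ (shareNoEdge? w) (unique-M n))
           (unique-completions (2 * n) all!) ∈-neighbours⁻ ∈-neighbours⁺ ⟩
    length (completions (2 * n) (allFin (2 * n)) w)
      ≡⟨ length-completions-closed n (2 * n) (allFin (2 * n)) w all! (λ _ → ∈-allFin _) len (ℕₚ.≤-reflexive len) ⟩
    dd n
      ∎
    where
      open ≡-Reasoning
      all! = Uniqueₚ.allFin⁺ (2 * n)
      len = Listₚ.length-tabulate _

eigenvalue-of-neighbour-sums : ∀ n (h : Matching n → ℚ) λ′ → (∀ u → h u ≢ 0ℚ) →
  (∀ w → IsPerfectMatching w → sumOver (neighbours n w) h ≡ λ′ *ℚ h w) → IsEigenvalueΓ n λ′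
eigenvalue-of-neighbour-sums n h λ′ h≢0 sums = h ∘ vertex n , (some-vertex n , h≢0 _) , λ i → begin
  sumFin (N n) (λ j → adj n i j *ℚ h (vertex n j))                      ≡⟨ sumFin-lookup (M n) _ ⟩
  sumOver (M n) (λ u → indicator (shareNoEdge? (vertex n i)) u *ℚ h u)  ≡⟨ sumOver-filter _ (M n) h ⟩
  sumOver (neighbours n (vertex n i)) h                                  ≡⟨ sums _ (∈-M⁻ n (∈-lookup i)) ⟩
  λ′ *ℚ h (vertex n i)                                                   ∎
  where open ≡-Reasoning

sumOver-neighbours-const : ∀ n (w : Matching n) → IsPerfectMatching w → ∀ c →
  sumOver (neighbours n w) (λ _ → c) ≡ ι (dd n) *ℚ c
sumOver-neighbours-const n w w-pm c =
  trans (sumOver-const (neighbours n w) c) (cong (λ l → ι l *ℚ c) (Neighbours.length-neighbours {n} w w-pm))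

module EdgeZeroOne (m : ℕ) where

  -- dd n reduces to d * q.
  n d q : ℕ
  n = suc (suc m)
  d = 2 * suc m
  q = dd (suc m) + dd m

  contains01? : (u : Matching n) → Dec (lookup u zero ≡ suc zero)
  contains01? u = lookup u zero ≟ᶠ suc zero

  edge01-vector : Matching n → ℚ
  edge01-vector u = if does (contains01? u) then ι d else - 1ℚ

  edge01-vector-nonzero : ∀ u → edge01-vector u ≢ 0ℚ
  edge01-vector-nonzero u with does (contains01? u)
  ... | true = ι-nonzero d
  ... | false = λ ()

  edge01-vector-split : ∀ u → edge01-vector u ≡ indicator contains01? u *ℚ ι (suc d) +ℚ - 1ℚ
  edge01-vector-split u with does (contains01? u)
  ... | true = trans (solve 1 (λ x → x := con 1ℚ :* (con 1ℚ :+ x) :+ :- con 1ℚ) refl (ι d))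
                     (cong (λ y → 1ℚ *ℚ y +ℚ - 1ℚ) (sym (ι-suc d)))
    where open ℚ-Solver.+-*-Solver
  ... | false = sym (trans (cong (_+ℚ - 1ℚ) (ℚₚ.*-zeroˡ (ι (suc d)))) (ℚₚ.+-identityˡ (- 1ℚ)))

  module _ (w : Matching n) (w-pm : IsPerfectMatching w) where

    open AvoidingMatchings w (proj₁ ∘ w-pm) (proj₂ ∘ w-pm)
    open Neighbours {n} w w-pm

    neighbours01 : List (Matching n)
    neighbours01 = filter contains01? (neighbours n w)

    length-neighbours01-if-01∈w : W zero ≡ suc zero → length neighbours01 ≡ 0
    length-neighbours01-if-01∈w w01 = cong length (Listₚ.filter-none contains01? (All.tabulate no-neighbour))
      where
        no-neighbour : ∀ {u} → u ∈ neighbours n w → lookup u zero ≢ suc zero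
        no-neighbour u∈ u01 = proj₂ (∈-filter⁻ (shareNoEdge? w) {xs = M n} u∈) zero (trans w01 (sym u01))

    fuel : ℕ
    fuel = ℕ.pred (2 * n)

    -- allFin (2 * n) reduces to zero ∷ others, and completions (2 * n) (allFin (2 * n)) w to the
    -- concatenation of the branches fuel zero others w x.
    others : List (Fin (2 * n))
    others = Data.List.tabulate suc

    length-neighbours01-if-01∉w : W zero ≢ suc zero → length neighbours01 ≡ q
    length-neighbours01-if-01∉w w01̸ = begin
      length neighbours01
        ≡⟨ length-≡-of-same-elements unique-neighbours01 (unique-branch fuel {zero} {others} {w} {suc zero} all!)
             to from ⟩
      length (branch fuel zero others w (suc zero))
        ≡⟨ length-branch-inner m fuel zero (W zero) others w (suc zero) (closed⇒openEnds all! (λ _ → ∈-allFin _))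
             1∈ (w01̸ ∘ sym) length-others (ℕₚ.≤-reflexive (Listₚ.length-tabulate suc)) ⟩
      q
        ∎
      where
        open ≡-Reasoning
        all! = Uniqueₚ.allFin⁺ (2 * n)
        unique-neighbours01 = Uniqueₚ.filter⁺ contains01? (Uniqueₚ.filter⁺ (shareNoEdge? w) (unique-M n))
        length-others : length others ≡ suc (2 * suc m)
        length-others = ℕₚ.suc-injective (trans (Listₚ.length-tabulate (λ i → i)) (double-suc (suc m)))
        1∈ : suc zero ∈ others
        1∈ = ∈-tail (∈-allFin (suc zero)) (λ ())
        1∈choices = ∈-remove⁺ 1∈ (w01̸ ∘ sym)
        to : ∀ {g} → g ∈ neighbours01 → g ∈ branch fuel zero others w (suc zero)
        to g∈ with ∈-filter⁻ contains01? {xs = neighbours n w} g∈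
        ... | g∈nb , g01 = completions⊆branch fuel {zero} {others} {w} all! (∈-neighbours⁻ g∈nb) g01
        from : ∀ {g} → g ∈ branch fuel zero others w (suc zero) → g ∈ neighbours01
        from g∈ = ∈-filter⁺ contains01?
          (∈-neighbours⁺ (branch⊆completions fuel {zero} {others} {w} 1∈choices g∈))
          (branch-pivot fuel {zero} {others} {w} all! 1∈choices g∈)

    sumOver-neighbours-edge01 : sumOver (neighbours n w) edge01-vector
      ≡ ι (length neighbours01) *ℚ ι (suc d) +ℚ ι (d * q) *ℚ (- 1ℚ)
    sumOver-neighbours-edge01 = begin
      sumOver (neighbours n w) edge01-vector
        ≡⟨ sumOver-cong (neighbours n w) edge01-vector-split ⟩
      sumOver (neighbours n w) (λ u → indicator contains01? u *ℚ ι (suc d) +ℚ - 1ℚ)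
        ≡⟨ sumOver-+ (neighbours n w) _ _ ⟩
      sumOver (neighbours n w) (λ u → indicator contains01? u *ℚ ι (suc d))
        +ℚ sumOver (neighbours n w) (λ _ → - 1ℚ)
        ≡⟨ cong₂ _+ℚ_ (trans (sumOver-filter contains01? (neighbours n w) _) (sumOver-const neighbours01 _))
                      (sumOver-neighbours-const n w w-pm (- 1ℚ)) ⟩
      ι (length neighbours01) *ℚ ι (suc d) +ℚ ι (d * q) *ℚ (- 1ℚ)
        ∎
      where open ≡-Reasoning

    sumOver-neighbours-edge01-eigen :
      sumOver (neighbours n w) edge01-vector ≡ (- (ℤ.+ dd n / d)) *ℚ edge01-vector w
    sumOver-neighbours-edge01-eigen with contains01? w
    ... | yes w01 = begin
      sumOver (neighbours n w) edge01-vector                  ≡⟨ sumOver-neighbours-edge01 ⟩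
      ι (length neighbours01) *ℚ ι (suc d) +ℚ ι (d * q) *ℚ (- 1ℚ)
        ≡⟨ cong₂ (λ l x → ι l *ℚ ι (suc d) +ℚ x *ℚ (- 1ℚ)) (length-neighbours01-if-01∈w w01) (ι-* d q) ⟩
      0ℚ *ℚ ι (suc d) +ℚ (ι d *ℚ ι q) *ℚ (- 1ℚ)
        ≡⟨ solve 3 (λ s d q → con 0ℚ :* s :+ (d :* q) :* (:- con 1ℚ) := (:- q) :* d) refl
             (ι (suc d)) (ι d) (ι q) ⟩
      (- ι q) *ℚ ι d                                          ≡⟨ cong (λ x → (- x) *ℚ ι d) (sym (ι-/ d q)) ⟩
      (- (ℤ.+ (d * q) / d)) *ℚ ι d                            ∎
      where
        open ≡-Reasoning
        open ℚ-Solver.+-*-Solver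
    ... | no w01̸ = begin
      sumOver (neighbours n w) edge01-vector                  ≡⟨ sumOver-neighbours-edge01 ⟩
      ι (length neighbours01) *ℚ ι (suc d) +ℚ ι (d * q) *ℚ (- 1ℚ)
        ≡⟨ cong₂ (λ l x → ι l *ℚ ι (suc d) +ℚ x *ℚ (- 1ℚ)) (length-neighbours01-if-01∉w w01̸) (ι-* d q) ⟩
      ι q *ℚ ι (suc d) +ℚ (ι d *ℚ ι q) *ℚ (- 1ℚ)
        ≡⟨ cong (λ x → ι q *ℚ x +ℚ (ι d *ℚ ι q) *ℚ (- 1ℚ)) (ι-suc d) ⟩
      ι q *ℚ (1ℚ +ℚ ι d) +ℚ (ι d *ℚ ι q) *ℚ (- 1ℚ)
        ≡⟨ solve 2 (λ d q → q :* (con 1ℚ :+ d) :+ (d :* q) :* (:- con 1ℚ) := (:- q) :* (:- con 1ℚ)) refl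
             (ι d) (ι q) ⟩
      (- ι q) *ℚ (- 1ℚ)                                       ≡⟨ cong (λ x → (- x) *ℚ (- 1ℚ)) (sym (ι-/ d q)) ⟩
      (- (ℤ.+ (d * q) / d)) *ℚ (- 1ℚ)                         ∎
      where
        open ≡-Reasoning
        open ℚ-Solver.+-*-Solver

theorem3p7 : (m : ℕ) →
    IsEigenvalueΓ (suc (suc m)) ((ℤ.+ dd (suc (suc m))) / 1)
    × IsEigenvalueΓ (suc (suc m)) (- ((ℤ.+ dd (suc (suc m))) / (2 * suc m)))
theorem3p7 m =
    eigenvalue-of-neighbour-sums n (λ _ → 1ℚ) (ℤ.+ dd n / 1) (λ _ ())
      (λ w w-pm → sumOver-neighbours-const n w w-pm 1ℚ)
  , eigenvalue-of-neighbour-sums n edge01-vector (- (ℤ.+ dd n / d)) edge01-vector-nonzero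
      sumOver-neighbours-edge01-eigen
  where open EdgeZeroOne m
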